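{- Let $r,r' \geq 1$ and $s,s' \geq 0$ be integers, and let $p \geq 3$ be a prime. Then: (i) If $s \equiv s' \pmod{p-1}$, then $\Psi_{r,s}(p) = \Psi_{r,s'}(p)$. (ii) If $r \equiv r' \pmod{p-1}$, then $\Psi_{r,s}(p) \equiv \Psi_{r',s}(p) \pmod{p}$. (iii) If moreover $s \geq 1$, then $(-1)^r \, \Psi_{r,s}(p) \equiv (-1)^s \, \Psi_{s,r}(p) \pmod{p}$.
   Context: For integers $r,s \geq 0$ and a prime $p$, define \[ \Psi_{r,s}(p) = \sum_{\substack{0 \leq \nu \leq r\\ 2 \,\mid\, s+\nu\\ p-1 \,\mid\, s+\nu}} \binom{r}{\nu}. \] -}

module Defs where

open import Data.Nat using (ℕ; zero; suc; _+_; _∸_; _*_)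
open import Data.Nat.Combinatorics using (_C_)
open import Data.Nat.Divisibility using (_∣_; _∣?_)
open import Relation.Nullary using (yes; no)
open import Data.Product using (_×_; _,_)
open import Relation.Nullary.Decidable using (_×-dec_)
open import Data.Integer as ℤ using (ℤ; +_; _-_)
import Data.Integer.Divisibility as ℤD

Ψ-sum : ℕ → ℕ → ℕ → ℕ → ℕ
Ψ-sum r s p zero = 0
Ψ-sum r s p (suc n) with (2 ∣? (s + n)) ×-dec ((p ∸ 1) ∣? (s + n))
... | yes _ = Ψ-sum r s p n + r C n
... | no  _ = Ψ-sum r s p n

Ψ : ℕ → ℕ → ℕ → ℕ
Ψ r s p = Ψ-sum r s p (suc r)

_≡_[modℤ_] : ℤ → ℤ → ℕ → Set
a ≡ b [modℤ m ] = (+ m) ℤD.∣ (a - b)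

sgn : ℕ → ℤ
sgn zero = + 1
sgn (suc n) = ℤ.- sgn n

{-# OPTIONS --safe #-}
-- Modulo p, write powerSum k = Σ_{a<p} a^k and T r s = Σ_{a<p} a^s (1+a)^r. Expanding (1+a)^r
-- binomially gives T r s = Σ_ν C(r,ν) powerSum (s+ν). Fermat's little theorem and the recurrence
-- for power sums coming from the shift a ↦ a+1 show that, for k ≥ 1, powerSum k ≡ -1 when p-1 ∣ k
-- and powerSum k ≡ 0 otherwise; as p-1 is even, this says exactly Ψ r s ≡ -T r s for s ≥ 1.
-- Part (ii) then follows from Fermat's periodicity of r ↦ a^r, part (iii) from the reflection
-- a ↦ p-1-a, which turns T r s into (-1)^(r+s) T s r, and part (i) holds because the summation
-- condition only depends on s modulo p-1.
module Submission where

open import Defs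
open import Algebra.Bundles using (Monoid; AbelianGroup; CommutativeSemiring; CommutativeRing)
open import Data.Empty using (⊥-elim)
open import Data.Fin.Base using (Fin; toℕ; opposite)
open import Data.Fin.Properties using (toℕ<n; toℕ-inject₁; toℕ-fromℕ; opposite-prop)
import Data.Fin.Permutation as Perm
open import Data.Integer as ℤ using (ℤ; +_)
import Data.Integer.Properties as ℤP
import Data.Integer.Divisibility.Signed as S
open import Data.Nat as ℕ using (ℕ; zero; suc; _∸_; _<_; _≤_; _!; z<s; s<s)
open import Data.Nat.Combinatorics using (_C_; nCn≡1; nC1≡n; nCk≡nC[n∸k]; nCk≡n!/k![n-k]!; k![n∸k]!∣n!)
open import Data.Nat.Divisibility
  using (_∣_; _∣?_; divides; ∣-refl; ∣-trans; ∣⇒≤; ∣1⇒≡1; m∣m*n; ∣m∣n⇒∣m+n; m%n≡0⇒n∣m)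
open import Data.Nat.DivMod using (_%_; _/_; m≡m%n+[m/n]*n; m%n<n; m/n*n≡m)
open import Data.Nat.Induction using (<-rec)
open import Data.Nat.Primality using (Prime; ¬prime[0]; ¬prime[1]; euclidsLemma; prime⇒irreducible)
import Data.Nat.Properties as ℕP
open import Data.Product using (_,_; ∃-syntax)
open import Data.Sum using (_⊎_; inj₁; inj₂)
open import Function using (_∘_)
open import Function.Bundles using (_⇔_; mk⇔; Equivalence)
open import Level using (0ℓ)
open import Relation.Binary.PropositionalEquality as ≡ using (_≡_)
open import Relation.Nullary using (¬_; yes; no)
open import Relation.Nullary.Decidable using (_×-dec_)

open Equivalence using (to; from)

module _ {a ℓ} (M : Monoid a ℓ) where
  open Monoid M renaming (_∙_ to _+_)
  open import Algebra.Properties.Monoid.Sum M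

  ∑-last : ∀ n (f : ℕ → Carrier) → ∑[ i < suc n ] f (toℕ i) ≈ ∑[ i < n ] f (toℕ i) + f n
  ∑-last n f = trans (sum-init-last (λ i → f (toℕ i)))
    (∙-cong (reflexive (sum-cong-≗ {n} (λ i → ≡.cong f (toℕ-inject₁ i))))
            (reflexive (≡.cong f (toℕ-fromℕ n))))

module _ {a ℓ} (G : AbelianGroup a ℓ) where
  open AbelianGroup G renaming (_∙_ to _+_)
  open import Algebra.Properties.Group group using (∙-cancelˡ)
  open import Algebra.Properties.Monoid.Sum monoid
  open import Relation.Binary.Reasoning.Setoid setoid

  ∑-rotate : ∀ n (f : ℕ → Carrier) → f n ≈ f 0 → ∑[ i < n ] f (suc (toℕ i)) ≈ ∑[ i < n ] f (toℕ i)
  ∑-rotate n f fn≈f0 = ∙-cancelˡ (f 0) _ _ (begin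
    f 0 + ∑[ i < n ] f (suc (toℕ i))  ≈⟨ ∑-last monoid n f ⟩
    ∑[ i < n ] f (toℕ i) + f n        ≈⟨ ∙-congˡ fn≈f0 ⟩
    ∑[ i < n ] f (toℕ i) + f 0        ≈⟨ comm _ _ ⟩
    f 0 + ∑[ i < n ] f (toℕ i)        ∎)

module _ {a ℓ} (R : CommutativeSemiring a ℓ) where
  open CommutativeSemiring R
  open import Algebra.Properties.CommutativeSemiring.Binomial R using (theorem)
  open import Algebra.Properties.Semiring.Exp semiring using (_^_; ^-congˡ)
  open import Algebra.Properties.Semiring.Mult semiring using (_×_; ×-assoc-*; ×-congʳ)
  open import Algebra.Properties.Semiring.Sum semiring using (sum-syntax; sum⁺-syntax; sum-cong-≋)
  open import Relation.Binary.Reasoning.Setoid setoid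

  1^n≈1 : ∀ n → 1# ^ n ≈ 1#
  1^n≈1 zero = refl
  1^n≈1 (suc n) = trans (*-identityˡ _) (1^n≈1 n)

  binomial-1+ : ∀ x n → (1# + x) ^ n ≈ ∑[ k ≤ n ] (((n C toℕ k) × 1#) * x ^ toℕ k)
  binomial-1+ x n = begin
    (1# + x) ^ n                                              ≈⟨ ^-congˡ n (+-comm 1# x) ⟩
    (x + 1#) ^ n                                              ≈⟨ theorem n x 1# ⟩
    ∑[ k ≤ n ] ((n C toℕ k) × (x ^ toℕ k * 1# ^ (n ∸ toℕ k)))  ≈⟨ sum-cong-≋ {suc n} (λ k → term (n C toℕ k) (toℕ k) (n ∸ toℕ k)) ⟩
    ∑[ k ≤ n ] (((n C toℕ k) × 1#) * x ^ toℕ k)               ∎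
    where
    term : ∀ c k m → c × (x ^ k * 1# ^ m) ≈ (c × 1#) * x ^ k
    term c k m = begin
      c × (x ^ k * 1# ^ m)  ≈⟨ ×-congʳ c (trans (*-congˡ (1^n≈1 m)) (*-identityʳ _)) ⟩
      c × x ^ k             ≈⟨ ×-congʳ c (*-identityˡ _) ⟨
      c × (1# * x ^ k)      ≈⟨ ×-assoc-* c 1# _ ⟨
      (c × 1#) * x ^ k      ∎

module _ where
  open import Algebra.Structures using (IsCommutativeRing)
  open import Data.Integer using (0ℤ; 1ℤ; _+_; _-_; _*_; -_)
  open import Data.Integer.Tactic.RingSolver using (solve-∀)

  -- A record, so that both sides of a congruence can be recovered from its type.
  infix 4 _≡_[mod_]
  record _≡_[mod_] (x y : ℤ) (n : ℕ) : Set where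
    constructor mod
    field unmod : x ≡ y [modℤ n ]
  open _≡_[mod_] public

  module _ {n : ℕ} where
    private
      mod-by : ∀ {x y e} → (+ n) S.∣ e → e ≡ x - y → x ≡ y [mod n ]
      mod-by n∣e ≡.refl = mod (S.∣⇒∣ᵤ n∣e)

      ∣-diff : ∀ {x y} → x ≡ y [mod n ] → (+ n) S.∣ (x - y)
      ∣-diff (mod x≡y) = S.∣ᵤ⇒∣ x≡y

    ≡⇒≡mod : ∀ {x y} → x ≡ y → x ≡ y [mod n ]
    ≡⇒≡mod {x} ≡.refl = mod-by (S.divides 0ℤ ≡.refl) (≡.sym (ℤP.+-inverseʳ x))

    ≡mod-sym : ∀ {x y} → x ≡ y [mod n ] → y ≡ x [mod n ]
    ≡mod-sym {x} {y} x≡y = mod-by (S.∣m⇒∣-m (∣-diff x≡y)) (eq x y)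
      where eq : ∀ x y → - (x - y) ≡ y - x
            eq = solve-∀

    ≡mod-trans : ∀ {x y z} → x ≡ y [mod n ] → y ≡ z [mod n ] → x ≡ z [mod n ]
    ≡mod-trans {x} {y} {z} x≡y y≡z = mod-by (S.∣m∣n⇒∣m+n (∣-diff x≡y) (∣-diff y≡z)) (eq x y z)
      where eq : ∀ x y z → (x - y) + (y - z) ≡ x - z
            eq = solve-∀

    +-cong-mod : ∀ {x y u v} → x ≡ y [mod n ] → u ≡ v [mod n ] → x + u ≡ y + v [mod n ]
    +-cong-mod {x} {y} {u} {v} x≡y u≡v = mod-by (S.∣m∣n⇒∣m+n (∣-diff x≡y) (∣-diff u≡v)) (eq x y u v)
      where eq : ∀ x y u v → (x - y) + (u - v) ≡ (x + u) - (y + v)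
            eq = solve-∀

    *-cong-mod : ∀ {x y u v} → x ≡ y [mod n ] → u ≡ v [mod n ] → x * u ≡ y * v [mod n ]
    *-cong-mod {x} {y} {u} {v} x≡y u≡v =
      mod-by (S.∣m∣n⇒∣m+n (S.∣n⇒∣m*n x (∣-diff u≡v)) (S.∣m⇒∣m*n v (∣-diff x≡y))) (eq x y u v)
      where eq : ∀ x y u v → x * (u - v) + (x - y) * v ≡ x * u - y * v
            eq = solve-∀

    neg-cong-mod : ∀ {x y} → x ≡ y [mod n ] → - x ≡ - y [mod n ]
    neg-cong-mod {x} {y} x≡y = mod-by (S.∣m⇒∣-m (∣-diff x≡y)) (eq x y)
      where eq : ∀ x y → - (x - y) ≡ - x - - y
            eq = solve-∀

    ∣⇒≡0 : ∀ {x} → (+ n) S.∣ x → x ≡ 0ℤ [mod n ]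
    ∣⇒≡0 {x} n∣x = mod-by n∣x (≡.sym (ℤP.+-identityʳ x))

    ≡0⇒∣ : ∀ {x} → x ≡ 0ℤ [mod n ] → (+ n) S.∣ x
    ≡0⇒∣ {x} x≡0 = ≡.subst ((+ n) S.∣_) (ℤP.+-identityʳ x) (∣-diff x≡0)

    ℕ∣⇔≡0 : ∀ {k} → n ∣ k ⇔ (+ k) ≡ 0ℤ [mod n ]
    ℕ∣⇔≡0 = mk⇔ (λ n∣k → ∣⇒≡0 (S.∣ᵤ⇒∣ n∣k)) (λ k≡0 → S.∣⇒∣ᵤ (≡0⇒∣ k≡0))

  -- Opaque copies of the operations of ℤ: ring expressions in ℤ-mod n then stay in normal form
  -- instead of unfolding into sign/magnitude terms, which unification could not invert.
  infixl 6 _+ᵐ_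
  infixl 7 _*ᵐ_
  infix 8 -ᵐ_

  opaque
    _+ᵐ_ _*ᵐ_ : ℤ → ℤ → ℤ
    _+ᵐ_ = _+_
    _*ᵐ_ = _*_

    -ᵐ_ : ℤ → ℤ
    -ᵐ_ = -_

  opaque
    unfolding _+ᵐ_ _*ᵐ_ -ᵐ_

    ℤ-mod-isCommutativeRing : ∀ n → IsCommutativeRing _≡_[mod n ] _+ᵐ_ _*ᵐ_ -ᵐ_ 0ℤ 1ℤ
    ℤ-mod-isCommutativeRing n = record
      { isRing = record
        { +-isAbelianGroup = record
          { isGroup = record
            { isMonoid = record
              { isSemigroup = record
                { isMagma = record
                  { isEquivalence = record { refl = ≡⇒≡mod ≡.refl ; sym = ≡mod-sym ; trans = ≡mod-trans }
                  ; ∙-cong = +-cong-mod }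
                ; assoc = λ x y z → ≡⇒≡mod (ℤP.+-assoc x y z) }
              ; identity = (λ x → ≡⇒≡mod (ℤP.+-identityˡ x)) , (λ x → ≡⇒≡mod (ℤP.+-identityʳ x)) }
            ; inverse = (λ x → ≡⇒≡mod (ℤP.+-inverseˡ x)) , (λ x → ≡⇒≡mod (ℤP.+-inverseʳ x))
            ; ⁻¹-cong = neg-cong-mod }
          ; comm = λ x y → ≡⇒≡mod (ℤP.+-comm x y) }
        ; *-cong = *-cong-mod
        ; *-assoc = λ x y z → ≡⇒≡mod (ℤP.*-assoc x y z)
        ; *-identity = (λ x → ≡⇒≡mod (ℤP.*-identityˡ x)) , (λ x → ≡⇒≡mod (ℤP.*-identityʳ x))
        ; distrib = (λ x y z → ≡⇒≡mod (ℤP.*-distribˡ-+ x y z)) , (λ x y z → ≡⇒≡mod (ℤP.*-distribʳ-+ x y z)) }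
      ; *-comm = λ x y → ≡⇒≡mod (ℤP.*-comm x y) }

    pos-+ᵐ : ∀ a b → + a +ᵐ + b ≡ + (a ℕ.+ b)
    pos-+ᵐ a b = ≡.refl

    *ᵐ≡* : ∀ x y → x *ᵐ y ≡ x * y
    *ᵐ≡* x y = ≡.refl

    -ᵐ≡- : ∀ x → -ᵐ x ≡ - x
    -ᵐ≡- x = ≡.refl

ℤ-mod : ℕ → CommutativeRing 0ℓ 0ℓ
ℤ-mod n = record { isCommutativeRing = ℤ-mod-isCommutativeRing n }

module _ {n : ℕ} where
  open CommutativeRing (ℤ-mod n) using (setoid; +-congʳ; +-identityˡ)
  open import Algebra.Properties.Group (CommutativeRing.+-group (ℤ-mod n)) using (∙-cancelʳ)
  open import Relation.Binary.Reasoning.Setoid setoid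

  ∣-cong-mod : ∀ {a b} c → (+ a) ≡ (+ b) [mod n ] → n ∣ a ℕ.+ c → n ∣ b ℕ.+ c
  ∣-cong-mod {a} {b} c a≡b n∣a+c = from ℕ∣⇔≡0 (begin
    + (b ℕ.+ c)  ≡⟨ pos-+ᵐ b c ⟨
    + b +ᵐ + c   ≈⟨ +-congʳ (≡mod-sym a≡b) ⟩
    + a +ᵐ + c   ≡⟨ pos-+ᵐ a c ⟩
    + (a ℕ.+ c)  ≈⟨ to ℕ∣⇔≡0 n∣a+c ⟩
    + 0          ∎)

  ≡mod⇒≡+* : ∀ {a b} → a ≤ b → (+ a) ≡ (+ b) [mod n ] → ∃[ q ] b ≡ a ℕ.+ q ℕ.* n
  ≡mod⇒≡+* {a} {b} a≤b a≡b with from ℕ∣⇔≡0 (∙-cancelʳ (+ a) (+ (b ∸ a)) (+ 0) (begin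
      + (b ∸ a) +ᵐ + a     ≡⟨ pos-+ᵐ (b ∸ a) a ⟩
      + (b ∸ a ℕ.+ a)      ≡⟨ ≡.cong +_ (ℕP.m∸n+n≡m a≤b) ⟩
      + b                  ≈⟨ ≡mod-sym a≡b ⟩
      + a                  ≈⟨ +-identityˡ (+ a) ⟨
      + 0 +ᵐ + a           ∎))
  ... | divides q b∸a≡q*n =
    q , ≡.trans (≡.sym (ℕP.m∸n+n≡m a≤b)) (≡.trans (ℕP.+-comm (b ∸ a) a) (≡.cong (a ℕ.+_) b∸a≡q*n))

prime∤ : ∀ {p k} → Prime p → 0 < k → k < p → ¬ p ∣ k
prime∤ {k = suc _} _ _ k<p p∣k = ℕP.<⇒≱ k<p (∣⇒≤ p∣k)

prime∤! : ∀ {p} → Prime p → ∀ m → m < p → ¬ p ∣ m !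
prime∤! pr zero _ p∣1 = ¬prime[1] (≡.subst Prime (∣1⇒≡1 p∣1) pr)
prime∤! pr (suc m) m<p p∣m! with euclidsLemma (suc m) (m !) pr p∣m!
... | inj₁ p∣1+m = prime∤ pr z<s m<p p∣1+m
... | inj₂ p∣m!  = prime∤! pr m (ℕP.<-trans (ℕP.n<1+n m) m<p) p∣m!

prime∣C : ∀ {p k} → Prime p → 0 < k → k < p → p ∣ p C k
prime∣C {zero} pr _ _ = ⊥-elim (¬prime[0] pr)
prime∣C {p@(suc d)} {k} pr 0<k k<p with euclidsLemma (p C k) (k ! ℕ.* (p ∸ k) !) pr p∣C*k!*[p∸k]!
  where
  k≤p : k ≤ p
  k≤p = ℕP.<⇒≤ k<p
  instance
    k!*[p∸k]!≢0 : ℕ.NonZero (k ! ℕ.* (p ∸ k) !)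
    k!*[p∸k]!≢0 = ℕP.m*n≢0 (k !) ((p ∸ k) !) {{k ℕP.!≢0}} {{(p ∸ k) ℕP.!≢0}}
  p∣C*k!*[p∸k]! : p ∣ (p C k) ℕ.* (k ! ℕ.* (p ∸ k) !)
  p∣C*k!*[p∸k]! = ≡.subst (p ∣_)
    (≡.sym (≡.trans (≡.cong (ℕ._* (k ! ℕ.* (p ∸ k) !)) (nCk≡n!/k![n-k]! k≤p)) (m/n*n≡m (k![n∸k]!∣n! k≤p))))
    (m∣m*n (d !))
... | inj₁ p∣C = p∣C
... | inj₂ p∣k!*[p∸k]! with euclidsLemma (k !) ((p ∸ k) !) pr p∣k!*[p∸k]!
...   | inj₁ p∣k!     = ⊥-elim (prime∤! pr k k<p p∣k!)
...   | inj₂ p∣[p∸k]! = ⊥-elim (prime∤! pr (p ∸ k) (ℕP.∸-monoʳ-< 0<k (ℕP.<⇒≤ k<p)) p∣[p∸k]!)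

2∣n⊎2∣1+n : ∀ n → 2 ∣ n ⊎ 2 ∣ suc n
2∣n⊎2∣1+n zero = inj₁ (divides 0 ≡.refl)
2∣n⊎2∣1+n (suc n) with 2∣n⊎2∣1+n n
... | inj₁ 2∣n   = inj₂ (∣m∣n⇒∣m+n (∣-refl {2}) 2∣n)
... | inj₂ 2∣1+n = inj₁ 2∣1+n

prime>2⇒2∣p∸1 : ∀ {p} → Prime p → 2 < p → 2 ∣ p ∸ 1
prime>2⇒2∣p∸1 {suc d} pr 2<p with 2∣n⊎2∣1+n d
... | inj₁ 2∣d = 2∣d
... | inj₂ 2∣p with prime⇒irreducible pr 2∣p
...   | inj₁ ()
...   | inj₂ ≡.refl = ⊥-elim (ℕP.<-irrefl ≡.refl 2<p)

open import Data.Product using (_×_)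

Ψ-sum-cong : ∀ r {s s′} p →
  (∀ ν → (2 ∣ s ℕ.+ ν × p ∸ 1 ∣ s ℕ.+ ν) ⇔ (2 ∣ s′ ℕ.+ ν × p ∸ 1 ∣ s′ ℕ.+ ν)) →
  ∀ n → Ψ-sum r s p n ≡ Ψ-sum r s′ p n
Ψ-sum-cong r p cond⇔ zero = ≡.refl
Ψ-sum-cong r {s} {s′} p cond⇔ (suc n)
  with (2 ∣? (s ℕ.+ n)) ×-dec ((p ∸ 1) ∣? (s ℕ.+ n)) | (2 ∣? (s′ ℕ.+ n)) ×-dec ((p ∸ 1) ∣? (s′ ℕ.+ n))
... | yes _ | yes _  = ≡.cong (ℕ._+ r C n) (Ψ-sum-cong r p cond⇔ n)
... | no _  | no _   = Ψ-sum-cong r p cond⇔ n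
... | yes c | no ¬c′ = ⊥-elim (¬c′ (to (cond⇔ n) c))
... | no ¬c | yes c′ = ⊥-elim (¬c (from (cond⇔ n) c′))

Ψ-cong-s : ∀ r {s s′} p → 2 ∣ p ∸ 1 → (+ s) ≡ (+ s′) [mod p ∸ 1 ] → Ψ r s p ≡ Ψ r s′ p
Ψ-cong-s r p 2∣p∸1 s≡s′ =
  Ψ-sum-cong r p (λ ν → mk⇔ (condition (∣-cong-mod ν s≡s′)) (condition (∣-cong-mod ν (≡mod-sym s≡s′)))) (suc r)
  where
  condition : ∀ {k k′} → (p ∸ 1 ∣ k → p ∸ 1 ∣ k′) → 2 ∣ k × p ∸ 1 ∣ k → 2 ∣ k′ × p ∸ 1 ∣ k′
  condition d∣k⇒d∣k′ (_ , d∣k) = ∣-trans 2∣p∸1 (d∣k⇒d∣k′ d∣k) , d∣k⇒d∣k′ d∣k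

-- The prime is written m + 2, so that p ∸ 1 reduces to the successor d = m + 1.
module _ {m : ℕ} (prime : Prime (suc (suc m))) where
  private
    d p : ℕ
    d = suc m
    p = suc d

  open CommutativeRing (ℤ-mod p)
  open import Algebra.Properties.Group +-group using (x∙y⁻¹≈ε⇒x≈y; inverseˡ-unique; inverseʳ-unique; identityˡ-unique; ⁻¹-involutive)
  open import Algebra.Properties.Ring ring using (x[y-z]≈xy-xz; -‿distribˡ-*; -‿distribʳ-*)
  open import Algebra.Properties.Semiring.Exp semiring using (_^_; ^-congˡ; ^-congʳ; ^-homo-*)
  open import Algebra.Properties.Semiring.Mult semiring using () renaming (_×_ to _·_)
  open import Algebra.Properties.Semiring.Sum semiring
    using (sum-syntax; sum⁺-syntax; sum-cong-≋; sum-cong-≗; sum-replicate; sum-replicate-zero; ∑-comm; ∑-permute; ∑-distrib-+; *-distribˡ-sum)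
  open import Algebra.Properties.CommutativeSemigroup *-commutativeSemigroup using (x∙yz≈y∙xz) renaming (interchange to *-interchange)
  open import Algebra.Properties.CommutativeSemigroup +-commutativeSemigroup using (interchange; xy∙z≈xz∙y)
  open import Relation.Binary.Reasoning.Setoid setoid

  ·1≡+ : ∀ n → n · 1# ≡ + n
  ·1≡+ zero = ≡.refl
  ·1≡+ (suc n) = ≡.trans (≡.cong (λ x → 1# + x) (·1≡+ n)) (pos-+ᵐ 1 n)

  binomial : ∀ x n → (1# + x) ^ n ≈ ∑[ k ≤ n ] (+ (n C toℕ k) * x ^ toℕ k)
  binomial x n = trans (binomial-1+ commutativeSemiring x n)
    (reflexive (sum-cong-≗ {suc n} (λ k → ≡.cong (_* x ^ toℕ k) (·1≡+ (n C toℕ k)))))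

  binomial-last : ∀ x k → (1# + x) ^ suc k ≈ ∑[ j ≤ k ] (+ (suc k C toℕ j) * x ^ toℕ j) + x ^ suc k
  binomial-last x k = begin
    (1# + x) ^ suc k                                  ≈⟨ binomial x (suc k) ⟩
    ∑[ j ≤ suc k ] term (toℕ j)                       ≈⟨ ∑-last +-monoid (suc k) term ⟩
    ∑[ j ≤ k ] term (toℕ j) + term (suc k)            ≈⟨ +-congˡ (reflexive (≡.cong (λ c → + c * x ^ suc k) (nCn≡1 (suc k)))) ⟩
    ∑[ j ≤ k ] term (toℕ j) + 1# * x ^ suc k          ≈⟨ +-congˡ (*-identityˡ _) ⟩
    ∑[ j ≤ k ] term (toℕ j) + x ^ suc k               ∎
    where
    term : ℕ → ℤ
    term j = + (suc k C j) * x ^ j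

  pCk≈0 : ∀ {k} → 0 < k → k < p → + (p C k) ≈ 0#
  pCk≈0 0<k k<p = to ℕ∣⇔≡0 (prime∣C prime 0<k k<p)

  frobenius-1+ : ∀ x → (1# + x) ^ p ≈ 1# + x ^ p
  frobenius-1+ x = begin
    (1# + x) ^ p                                          ≈⟨ binomial x p ⟩
    1# * 1# + ∑[ k < p ] term (suc (toℕ k))               ≈⟨ +-congʳ (*-identityˡ 1#) ⟩
    1# + ∑[ k < p ] term (suc (toℕ k))                    ≈⟨ +-congˡ (∑-last +-monoid d (term ∘ suc)) ⟩
    1# + (∑[ k < d ] term (suc (toℕ k)) + term p)         ≈⟨ +-congˡ (+-cong middle last) ⟩
    1# + (0# + x ^ p)                                     ≈⟨ +-congˡ (+-identityˡ _) ⟩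
    1# + x ^ p                                            ∎
    where
    term : ℕ → ℤ
    term k = + (p C k) * x ^ k
    middle : ∑[ k < d ] term (suc (toℕ k)) ≈ 0#
    middle = trans (sum-cong-≋ {d} (λ k → trans (*-congʳ (pCk≈0 z<s (s<s (toℕ<n k)))) (zeroˡ (x ^ suc (toℕ k)))))
                   (sum-replicate-zero d)
    last : term p ≈ x ^ p
    last = trans (reflexive (≡.cong (λ c → + c * x ^ p) (nCn≡1 p))) (*-identityˡ _)

  fermat : ∀ b → (+ b) ^ p ≈ + b
  fermat-1+ : ∀ b → (1# + + b) ^ p ≈ 1# + + b

  fermat zero = zeroˡ _
  fermat (suc b) = begin
    (+ suc b) ^ p     ≡⟨ ≡.cong (_^ p) (pos-+ᵐ 1 b) ⟨
    (1# + + b) ^ p    ≈⟨ fermat-1+ b ⟩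
    1# + + b          ≡⟨ pos-+ᵐ 1 b ⟩
    + suc b           ∎

  fermat-1+ b = trans (frobenius-1+ (+ b)) (+-congˡ (fermat b))

  *-cancelˡ-≈0 : ∀ {b x} → ¬ p ∣ b → + b * x ≈ 0# → x ≈ 0#
  *-cancelˡ-≈0 {b} {x} p∤b bx≈0 with euclidsLemma b ℤ.∣ x ∣ prime p∣b*∣x∣
    where
    p∣b*∣x∣ : p ∣ b ℕ.* ℤ.∣ x ∣
    p∣b*∣x∣ = ≡.subst (p ∣_) (≡.trans (≡.cong ℤ.∣_∣ (*ᵐ≡* (+ b) x)) (ℤP.abs-* (+ b) x))
                (S.∣⇒∣ᵤ (≡0⇒∣ bx≈0))
  ... | inj₁ p∣b   = ⊥-elim (p∤b p∣b)
  ... | inj₂ p∣∣x∣ = ∣⇒≡0 (S.∣ᵤ⇒∣ p∣∣x∣)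

  fermat-unit : ∀ {b} → 0 < b → b < p → (+ b) ^ d ≈ 1#
  fermat-unit {b} 0<b b<p = x∙y⁻¹≈ε⇒x≈y _ _ (*-cancelˡ-≈0 (prime∤ prime 0<b b<p) (begin
    + b * ((+ b) ^ d - 1#)  ≈⟨ x[y-z]≈xy-xz (+ b) _ _ ⟩
    (+ b) ^ p - + b * 1#    ≈⟨ +-cong (fermat b) (-‿cong (*-identityʳ (+ b))) ⟩
    + b - + b               ≈⟨ -‿inverseʳ (+ b) ⟩
    0#                      ∎))

  ^-periodic : ∀ {x} → x ^ p ≈ x → ∀ k q → x ^ (suc k ℕ.+ q ℕ.* d) ≈ x ^ suc k
  ^-periodic {x} xᵖ≈x k zero = ^-congʳ x (ℕP.+-identityʳ (suc k))
  ^-periodic {x} xᵖ≈x k (suc q) = begin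
    x ^ (suc k ℕ.+ (d ℕ.+ q ℕ.* d))  ≡⟨ ≡.cong (x ^_) (exponent k (q ℕ.* d)) ⟩
    x ^ (j ℕ.+ p)                    ≈⟨ ^-homo-* x j p ⟩
    x ^ j * x ^ p                    ≈⟨ *-congˡ xᵖ≈x ⟩
    x ^ j * x                        ≈⟨ *-comm (x ^ j) x ⟩
    x ^ (suc k ℕ.+ q ℕ.* d)          ≈⟨ ^-periodic xᵖ≈x k q ⟩
    x ^ suc k                        ∎
    where
    j : ℕ
    j = k ℕ.+ q ℕ.* d
    exponent : ∀ k n → suc k ℕ.+ (d ℕ.+ n) ≡ k ℕ.+ n ℕ.+ p
    exponent k n = ≡.trans (≡.cong (λ e → suc (k ℕ.+ e)) (ℕP.+-comm d n))
                           (≡.trans (≡.cong suc (≡.sym (ℕP.+-assoc k n d))) (≡.sym (ℕP.+-suc (k ℕ.+ n) d)))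

  p≈0 : + p ≈ 0#
  p≈0 = to ℕ∣⇔≡0 ∣-refl

  powerSum : ℕ → ℤ
  powerSum k = ∑[ a < p ] ((+ toℕ a) ^ k)

  -- Sum (1 + a)^(k+1) = Σ_{j≤k} C(k+1,j) a^j + a^(k+1) over a < p: modulo p the shift a ↦ a + 1
  -- leaves Σ_a a^(k+1) unchanged.
  powerSum-recurrence : ∀ k → ∑[ j ≤ k ] (+ (suc k C toℕ j) * powerSum (toℕ j)) ≈ 0#
  powerSum-recurrence k = identityˡ-unique _ _ (begin
    ∑[ j ≤ k ] (c j * powerSum (toℕ j)) + powerSum (suc k)
      ≈⟨ +-congʳ (sum-cong-≋ {suc k} (λ j → *-distribˡ-sum {p} (c j) (λ a → (+ toℕ a) ^ toℕ j))) ⟩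
    ∑[ j ≤ k ] (∑[ a < p ] (c j * (+ toℕ a) ^ toℕ j)) + powerSum (suc k)
      ≈⟨ +-congʳ (∑-comm {p} {suc k} (λ a j → c j * (+ toℕ a) ^ toℕ j)) ⟨
    ∑[ a < p ] (∑[ j ≤ k ] (c j * (+ toℕ a) ^ toℕ j)) + powerSum (suc k)
      ≈⟨ ∑-distrib-+ {p} (λ a → ∑[ j ≤ k ] (c j * (+ toℕ a) ^ toℕ j)) (λ a → (+ toℕ a) ^ suc k) ⟨
    ∑[ a < p ] (∑[ j ≤ k ] (c j * (+ toℕ a) ^ toℕ j) + (+ toℕ a) ^ suc k)
      ≈⟨ sum-cong-≋ {p} (λ a → binomial-last (+ toℕ a) k) ⟨
    ∑[ a < p ] ((1# + + toℕ a) ^ suc k)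
      ≡⟨ sum-cong-≗ {p} (λ a → ≡.cong (_^ suc k) (pos-+ᵐ 1 (toℕ a))) ⟩
    ∑[ a < p ] ((+ suc (toℕ a)) ^ suc k)
      ≈⟨ ∑-rotate +-abelianGroup p (λ a → (+ a) ^ suc k) (^-congˡ (suc k) p≈0) ⟩
    powerSum (suc k) ∎)
    where
    c : Fin (suc k) → ℤ
    c j = + (suc k C toℕ j)

  powerSum-vanishes : ∀ k → k < d → powerSum k ≈ 0#
  powerSum-vanishes = <-rec _ step
    where
    [1+k]Ck≡1+k : ∀ k → suc k C k ≡ suc k
    [1+k]Ck≡1+k k = ≡.trans (nCk≡nC[n∸k] (ℕP.n≤1+n k))
                      (≡.trans (≡.cong (suc k C_) (ℕP.m+n∸n≡m 1 k)) (nC1≡n (suc k)))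
    step : ∀ k → (∀ {j} → j < k → j < d → powerSum j ≈ 0#) → k < d → powerSum k ≈ 0#
    step k ih k<d = *-cancelˡ-≈0 (prime∤ prime z<s (s<s k<d)) (begin
      + suc k * powerSum k                                    ≡⟨ ≡.cong (λ c → + c * powerSum k) ([1+k]Ck≡1+k k) ⟨
      term k                                                  ≈⟨ +-identityˡ (term k) ⟨
      0# + term k                                             ≈⟨ +-congʳ lower ⟨
      ∑[ j < k ] term (toℕ j) + term k                        ≈⟨ ∑-last +-monoid k term ⟨
      ∑[ j ≤ k ] term (toℕ j)                                 ≈⟨ powerSum-recurrence k ⟩
      0#                                                      ∎)
      where
      term : ℕ → ℤ
      term j = + (suc k C j) * powerSum j
      lower : ∑[ j < k ] term (toℕ j) ≈ 0#
      lower = trans (sum-cong-≋ {k} (λ j → trans (*-congˡ (ih (toℕ<n j) (ℕP.<-trans (toℕ<n j) k<d))) (zeroʳ _)))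
                    (sum-replicate-zero k)

  powerSum-d : powerSum d ≈ - 1#
  powerSum-d = begin
    (+ 0) ^ d + ∑[ a < d ] ((+ suc (toℕ a)) ^ d)  ≈⟨ +-cong (zeroˡ ((+ 0) ^ m)) (sum-cong-≋ {d} (λ a → fermat-unit z<s (s<s (toℕ<n a)))) ⟩
    0# + ∑[ a < d ] 1#                            ≈⟨ +-identityˡ _ ⟩
    ∑[ a < d ] 1#                                 ≈⟨ sum-replicate d ⟩
    d · 1#                                        ≡⟨ ·1≡+ d ⟩
    + d                                           ≈⟨ inverseˡ-unique (+ d) 1# d+1≈0 ⟩
    - 1#                                          ∎
    where
    d+1≈0 : + d + 1# ≈ 0#
    d+1≈0 = trans (reflexive (≡.trans (pos-+ᵐ d 1) (≡.cong +_ (ℕP.+-comm d 1)))) p≈0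

  powerSum-periodic : ∀ k q → powerSum (suc k ℕ.+ q ℕ.* d) ≈ powerSum (suc k)
  powerSum-periodic k q = sum-cong-≋ {p} (λ a → ^-periodic (fermat (toℕ a)) k q)

  powerSum-∤ : ∀ {k} → ¬ d ∣ k → powerSum k ≈ 0#
  powerSum-∤ {k} d∤k with k % d in k%d≡
  ... | zero  = ⊥-elim (d∤k (m%n≡0⇒n∣m k d k%d≡))
  ... | suc j = begin
    powerSum k                        ≡⟨ ≡.cong powerSum (≡.trans (m≡m%n+[m/n]*n k d) (≡.cong (ℕ._+ k / d ℕ.* d) k%d≡)) ⟩
    powerSum (suc j ℕ.+ k / d ℕ.* d)  ≈⟨ powerSum-periodic j (k / d) ⟩
    powerSum (suc j)                  ≈⟨ powerSum-vanishes (suc j) (≡.subst (_< d) k%d≡ (m%n<n k d)) ⟩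
    0#                                ∎

  powerSum-∣ : ∀ {k} → 0 < k → d ∣ k → powerSum k ≈ - 1#
  powerSum-∣ 0<0 (divides zero ≡.refl) = ⊥-elim (ℕP.<-irrefl ≡.refl 0<0)
  powerSum-∣ _ (divides (suc q) ≡.refl) = trans (powerSum-periodic m q) powerSum-d

  T : ℕ → ℕ → ℤ
  T r s = ∑[ a < p ] ((+ toℕ a) ^ s * (1# + + toℕ a) ^ r)

  T-term : ℕ → ℕ → ℕ → ℤ
  T-term r s ν = + (r C ν) * powerSum (s ℕ.+ ν)

  T≈∑T-term : ∀ r s → T r s ≈ ∑[ ν ≤ r ] T-term r s (toℕ ν)
  T≈∑T-term r s = begin
    T r s
      ≈⟨ sum-cong-≋ {p} (λ a → *-congˡ {ι a ^ s} (binomial (ι a) r)) ⟩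
    ∑[ a < p ] (ι a ^ s * ∑[ ν ≤ r ] (c ν * ι a ^ toℕ ν))
      ≈⟨ sum-cong-≋ {p} (λ a → *-distribˡ-sum {suc r} (ι a ^ s) (λ ν → c ν * ι a ^ toℕ ν)) ⟩
    ∑[ a < p ] (∑[ ν ≤ r ] (ι a ^ s * (c ν * ι a ^ toℕ ν)))
      ≈⟨ sum-cong-≋ {p} (λ a → sum-cong-≋ {suc r} (λ ν → shift (ι a) (c ν) (toℕ ν))) ⟩
    ∑[ a < p ] (∑[ ν ≤ r ] (c ν * ι a ^ (s ℕ.+ toℕ ν)))
      ≈⟨ ∑-comm {p} {suc r} (λ a ν → c ν * ι a ^ (s ℕ.+ toℕ ν)) ⟩
    ∑[ ν ≤ r ] (∑[ a < p ] (c ν * ι a ^ (s ℕ.+ toℕ ν)))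
      ≈⟨ sum-cong-≋ {suc r} (λ ν → *-distribˡ-sum {p} (c ν) (λ a → ι a ^ (s ℕ.+ toℕ ν))) ⟨
    ∑[ ν ≤ r ] T-term r s (toℕ ν) ∎
    where
    ι : Fin p → ℤ
    ι a = + toℕ a
    c : Fin (suc r) → ℤ
    c ν = + (r C toℕ ν)
    shift : ∀ x c j → x ^ s * (c * x ^ j) ≈ c * x ^ (s ℕ.+ j)
    shift x c j = trans (x∙yz≈y∙xz (x ^ s) c (x ^ j)) (*-congˡ (sym (^-homo-* x s j)))

  T-term-∣ : ∀ r {s} n → 0 < s → d ∣ s ℕ.+ n → T-term r s n ≈ - + (r C n)
  T-term-∣ r {s} n 0<s d∣s+n = begin
    + (r C n) * powerSum (s ℕ.+ n)  ≈⟨ *-congˡ (powerSum-∣ (ℕP.<-≤-trans 0<s (ℕP.m≤m+n s n)) d∣s+n) ⟩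
    + (r C n) * - 1#                ≈⟨ -‿distribʳ-* (+ (r C n)) 1# ⟨
    - (+ (r C n) * 1#)              ≈⟨ -‿cong (*-identityʳ (+ (r C n))) ⟩
    - + (r C n)                     ∎

  T-term-∤ : ∀ r {s} n → ¬ d ∣ s ℕ.+ n → T-term r s n ≈ 0#
  T-term-∤ r n d∤s+n = trans (*-congˡ (powerSum-∤ d∤s+n)) (zeroʳ _)

  T-periodic : ∀ r q s → T (suc r ℕ.+ q ℕ.* d) s ≈ T (suc r) s
  T-periodic r q s = sum-cong-≋ {p} (λ a → *-congˡ {(+ toℕ a) ^ s} (^-periodic (fermat-1+ (toℕ a)) r q))

  sgn-suc : ∀ n → sgn (suc n) ≡ - sgn n
  sgn-suc n = ≡.sym (-ᵐ≡- (sgn n))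

  -x^n≈sgn*x^n : ∀ x n → (- x) ^ n ≈ sgn n * x ^ n
  -x^n≈sgn*x^n x zero = sym (*-identityˡ 1#)
  -x^n≈sgn*x^n x (suc n) = begin
    - x * (- x) ^ n            ≈⟨ *-congˡ (-x^n≈sgn*x^n x n) ⟩
    - x * (sgn n * x ^ n)      ≈⟨ -‿distribˡ-* x _ ⟨
    - (x * (sgn n * x ^ n))    ≈⟨ -‿cong (x∙yz≈y∙xz x (sgn n) (x ^ n)) ⟩
    - (sgn n * (x * x ^ n))    ≈⟨ -‿distribˡ-* (sgn n) _ ⟩
    - sgn n * x ^ suc n        ≡⟨ ≡.cong (_* x ^ suc n) (sgn-suc n) ⟨
    sgn (suc n) * x ^ suc n    ∎

  sgn*sgn≈1 : ∀ n → sgn n * sgn n ≈ 1#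
  sgn*sgn≈1 zero = *-identityˡ 1#
  sgn*sgn≈1 (suc n) = begin
    sgn (suc n) * sgn (suc n)  ≡⟨ ≡.cong₂ _*_ (sgn-suc n) (sgn-suc n) ⟩
    - sgn n * - sgn n          ≈⟨ -‿distribˡ-* (sgn n) _ ⟨
    - (sgn n * - sgn n)        ≈⟨ -‿cong (-‿distribʳ-* (sgn n) (sgn n)) ⟨
    - - (sgn n * sgn n)        ≈⟨ ⁻¹-involutive _ ⟩
    sgn n * sgn n              ≈⟨ sgn*sgn≈1 n ⟩
    1#                         ∎

  -- The reflection a ↦ p-1-a, where p-1-a ≡ -(1+a) and 1+(p-1-a) ≡ -a.
  reflect : ∀ {o i} → suc (o ℕ.+ i) ≡ p → ∀ r s →
            (+ o) ^ s * (1# + + o) ^ r ≈ sgn r * sgn s * ((+ i) ^ r * (1# + + i) ^ s)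
  reflect {o} {i} 1+o+i≡p r s = begin
    (+ o) ^ s * (1# + + o) ^ r                       ≈⟨ *-cong (^-congˡ s o≈-[1+i]) (^-congˡ r 1+o≈-i) ⟩
    (- (1# + + i)) ^ s * (- + i) ^ r                 ≈⟨ *-cong (-x^n≈sgn*x^n _ s) (-x^n≈sgn*x^n _ r) ⟩
    sgn s * (1# + + i) ^ s * (sgn r * (+ i) ^ r)     ≈⟨ *-interchange _ _ _ _ ⟩
    sgn s * sgn r * ((1# + + i) ^ s * (+ i) ^ r)     ≈⟨ *-cong (*-comm (sgn s) (sgn r)) (*-comm _ _) ⟩
    sgn r * sgn s * ((+ i) ^ r * (1# + + i) ^ s)     ∎
    where
    o≈-[1+i] : + o ≈ - (1# + + i)
    o≈-[1+i] = inverseˡ-unique (+ o) (1# + + i) (trans (reflexive (≡.trans (≡.cong (λ x → + o + x) (pos-+ᵐ 1 i))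
      (≡.trans (pos-+ᵐ o (suc i)) (≡.cong +_ (≡.trans (ℕP.+-suc o i) 1+o+i≡p))))) p≈0)
    1+o≈-i : 1# + + o ≈ - + i
    1+o≈-i = inverseˡ-unique (1# + + o) (+ i) (trans (reflexive (≡.trans (≡.cong (_+ + i) (pos-+ᵐ 1 o))
      (≡.trans (pos-+ᵐ (suc o) i) (≡.cong +_ 1+o+i≡p)))) p≈0)

  T-reflect : ∀ r s → T r s ≈ sgn r * sgn s * T s r
  T-reflect r s = begin
    T r s                                     ≈⟨ ∑-permute f Perm.reverse ⟩
    ∑[ a < p ] f (opposite a)                 ≈⟨ sum-cong-≋ {p} (λ a → reflect {toℕ (opposite a)} {toℕ a} (opposite+a a) r s) ⟩
    ∑[ a < p ] (sgn r * sgn s * g a)          ≈⟨ *-distribˡ-sum {p} (sgn r * sgn s) g ⟨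
    sgn r * sgn s * T s r                     ∎
    where
    f g : Fin p → ℤ
    f a = (+ toℕ a) ^ s * (1# + + toℕ a) ^ r
    g a = (+ toℕ a) ^ r * (1# + + toℕ a) ^ s
    opposite+a : ∀ a → suc (toℕ (opposite a) ℕ.+ toℕ a) ≡ p
    opposite+a a = ≡.trans (≡.sym (ℕP.+-suc (toℕ (opposite a)) (toℕ a)))
                     (≡.trans (≡.cong (ℕ._+ suc (toℕ a)) (opposite-prop a)) (ℕP.m∸n+n≡m (toℕ<n a)))

  sgn*T-symmetric : ∀ r s → sgn r * T r s ≈ sgn s * T s r
  sgn*T-symmetric r s = begin
    sgn r * T r s                      ≈⟨ *-congˡ (T-reflect r s) ⟩
    sgn r * (sgn r * sgn s * T s r)    ≈⟨ *-congˡ (*-assoc (sgn r) (sgn s) (T s r)) ⟩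
    sgn r * (sgn r * (sgn s * T s r))  ≈⟨ *-assoc (sgn r) (sgn r) _ ⟨
    sgn r * sgn r * (sgn s * T s r)    ≈⟨ *-congʳ (sgn*sgn≈1 r) ⟩
    1# * (sgn s * T s r)               ≈⟨ *-identityˡ _ ⟩
    sgn s * T s r                      ∎

  module _ (2∣d : 2 ∣ d) where

    -- As 2 ∣ p-1, the condition in Ψ-sum is just p-1 ∣ s+ν, exactly when powerSum (s+ν) ≡ -1.
    ∑T-term+Ψ-sum≈0 : ∀ r s → 0 < s → ∀ n → ∑[ ν < n ] T-term r s (toℕ ν) + + Ψ-sum r s p n ≈ 0#
    ∑T-term+Ψ-sum≈0 r s 0<s zero = +-identityˡ 0#
    ∑T-term+Ψ-sum≈0 r s 0<s (suc n) with (2 ∣? (s ℕ.+ n)) ×-dec (d ∣? (s ℕ.+ n))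
    ... | yes (_ , d∣s+n) = begin
      ∑[ ν < suc n ] T-term r s (toℕ ν) + + (Ψ-sum r s p n ℕ.+ r C n)
        ≈⟨ +-cong (∑-last +-monoid n (T-term r s)) (reflexive (≡.sym (pos-+ᵐ (Ψ-sum r s p n) (r C n)))) ⟩
      (∑[ ν < n ] T-term r s (toℕ ν) + T-term r s n) + (+ Ψ-sum r s p n + + (r C n))
        ≈⟨ interchange _ _ _ _ ⟩
      (∑[ ν < n ] T-term r s (toℕ ν) + + Ψ-sum r s p n) + (T-term r s n + + (r C n))
        ≈⟨ +-cong (∑T-term+Ψ-sum≈0 r s 0<s n) (+-congʳ (T-term-∣ r n 0<s d∣s+n)) ⟩
      0# + (- + (r C n) + + (r C n))
        ≈⟨ +-identityˡ _ ⟩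
      - + (r C n) + + (r C n)
        ≈⟨ -‿inverseˡ (+ (r C n)) ⟩
      0# ∎
    ... | no ¬2∣∧d∣ = begin
      ∑[ ν < suc n ] T-term r s (toℕ ν) + + Ψ-sum r s p n
        ≈⟨ +-congʳ (∑-last +-monoid n (T-term r s)) ⟩
      (∑[ ν < n ] T-term r s (toℕ ν) + T-term r s n) + + Ψ-sum r s p n
        ≈⟨ xy∙z≈xz∙y _ _ _ ⟩
      (∑[ ν < n ] T-term r s (toℕ ν) + + Ψ-sum r s p n) + T-term r s n
        ≈⟨ +-cong (∑T-term+Ψ-sum≈0 r s 0<s n) (T-term-∤ r n (λ d∣ → ¬2∣∧d∣ (∣-trans 2∣d d∣ , d∣))) ⟩
      0# + 0#
        ≈⟨ +-identityˡ 0# ⟩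
      0# ∎

    Ψ≈-T : ∀ r s → 0 < s → + Ψ r s p ≈ - T r s
    Ψ≈-T r s 0<s = inverseʳ-unique (T r s) (+ Ψ r s p)
      (trans (+-congʳ (T≈∑T-term r s)) (∑T-term+Ψ-sum≈0 r s 0<s (suc r)))

    Ψ-periodic : ∀ r q s → 0 < s → + Ψ (suc r ℕ.+ q ℕ.* d) s p ≈ + Ψ (suc r) s p
    Ψ-periodic r q s 0<s = begin
      + Ψ (suc r ℕ.+ q ℕ.* d) s p  ≈⟨ Ψ≈-T (suc r ℕ.+ q ℕ.* d) s 0<s ⟩
      - T (suc r ℕ.+ q ℕ.* d) s    ≈⟨ -‿cong (T-periodic r q s) ⟩
      - T (suc r) s                ≈⟨ Ψ≈-T (suc r) s 0<s ⟨
      + Ψ (suc r) s p              ∎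

    Ψ-cong-r-≤ : ∀ {r r′} s → 0 < r → 0 < s → r ≤ r′ → (+ r) ≡ (+ r′) [mod d ] → + Ψ r s p ≈ + Ψ r′ s p
    Ψ-cong-r-≤ {suc r} s _ 0<s r≤r′ r≡r′ with ≡mod⇒≡+* r≤r′ r≡r′
    ... | q , ≡.refl = sym (Ψ-periodic r q s 0<s)

    Ψ-cong-r-0<s : ∀ {r r′} s → 0 < r → 0 < r′ → 0 < s → (+ r) ≡ (+ r′) [mod d ] → + Ψ r s p ≈ + Ψ r′ s p
    Ψ-cong-r-0<s {r} {r′} s 0<r 0<r′ 0<s r≡r′ with ℕP.≤-total r r′
    ... | inj₁ r≤r′ = Ψ-cong-r-≤ s 0<r 0<s r≤r′ r≡r′
    ... | inj₂ r′≤r = sym (Ψ-cong-r-≤ s 0<r′ 0<s r′≤r (≡mod-sym r≡r′))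

    Ψ-cong-r : ∀ {r r′} s → 0 < r → 0 < r′ → (+ r) ≡ (+ r′) [mod d ] → + Ψ r s p ≈ + Ψ r′ s p
    Ψ-cong-r (suc s) 0<r 0<r′ r≡r′ = Ψ-cong-r-0<s (suc s) 0<r 0<r′ z<s r≡r′
    -- powerSum 0 = p ≡ 0 breaks the link with T at s = 0, so pass to s = p-1 by part (i).
    Ψ-cong-r {r} {r′} zero 0<r 0<r′ r≡r′ = begin
      + Ψ r 0 p   ≡⟨ ≡.cong +_ (Ψ-cong-s r p 2∣d 0≡d) ⟩
      + Ψ r d p   ≈⟨ Ψ-cong-r-0<s d 0<r 0<r′ z<s r≡r′ ⟩
      + Ψ r′ d p  ≡⟨ ≡.cong +_ (Ψ-cong-s r′ p 2∣d 0≡d) ⟨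
      + Ψ r′ 0 p  ∎
      where
      0≡d : (+ 0) ≡ (+ d) [mod d ]
      0≡d = ≡mod-sym (to ℕ∣⇔≡0 ∣-refl)

    Ψ-reciprocity : ∀ {r s} → 0 < r → 0 < s → sgn r * + Ψ r s p ≈ sgn s * + Ψ s r p
    Ψ-reciprocity {r} {s} 0<r 0<s = begin
      sgn r * + Ψ r s p   ≈⟨ *-congˡ (Ψ≈-T r s 0<s) ⟩
      sgn r * - T r s     ≈⟨ -‿distribʳ-* (sgn r) (T r s) ⟨
      - (sgn r * T r s)   ≈⟨ -‿cong (sgn*T-symmetric r s) ⟩
      - (sgn s * T s r)   ≈⟨ -‿distribʳ-* (sgn s) (T s r) ⟩
      sgn s * - T s r     ≈⟨ *-congˡ (Ψ≈-T s r 0<r) ⟨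
      sgn s * + Ψ s r p   ∎

open import Data.Nat using (_≥_; s≤s; z≤n)
open import Data.Integer using (_*_)

lemma4p3 : (r r′ s s′ p : ℕ) → r ≥ 1 → r′ ≥ 1 → Prime p → p ≥ 3 →
    ((+ s) ≡ (+ s′) [modℤ (p ∸ 1) ] → Ψ r s p ≡ Ψ r s′ p)
    × ((+ r) ≡ (+ r′) [modℤ (p ∸ 1) ] → (+ Ψ r s p) ≡ (+ Ψ r′ s p) [modℤ p ])
    × (s ≥ 1 → (sgn r * + Ψ r s p) ≡ (sgn s * + Ψ s r p) [modℤ p ])
lemma4p3 r r′ s s′ p@(suc (suc _)) r≥1 r′≥1 pr 3≤p@(s≤s (s≤s (s≤s z≤n))) =
    (λ s≡s′ → Ψ-cong-s r {s} {s′} p 2∣p∸1 (mod s≡s′))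
  , (λ r≡r′ → unmod (Ψ-cong-r pr 2∣p∸1 {r} {r′} s r≥1 r′≥1 (mod r≡r′)))
  , (λ s≥1 → unmod (≡.subst₂ (_≡_[mod p ]) (*ᵐ≡* (sgn r) _) (*ᵐ≡* (sgn s) _) (Ψ-reciprocity pr 2∣p∸1 {r} {s} r≥1 s≥1)))
  where
  2∣p∸1 : 2 ∣ p ∸ 1
  2∣p∸1 = prime>2⇒2∣p∸1 pr 3≤p
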